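{- Suppose every connective in $\mathcal{C}$ is monotonic. Let $\mathcal{K}=\langle W,\preceq,D,I\rangle$ be a constant domain Kripke model and $w\in W$. Let $\mathcal{M}_{\mathcal{K},w}=\langle D,J_{\mathcal{K},w}\rangle$ be the classical model with $J_{\mathcal{K},w}(p)=I(w,p)$ for every predicate symbol $p$. Then for every formula $\alpha$ over $\mathcal{C}$ and every assignment $\rho$ in $D$, $\|\alpha\|_{\mathcal{K},w}^\rho=[\![\alpha]\!]_{\mathcal{M}_{\mathcal{K},w}}^\rho$.
   Context: A propositional connective $c$ has a truth function $f_c:\{0,1\}^{n}\to\{0,1\}$, $n=\mathrm{ar}(c)$; it is monotonic if $\mathbf{a}[i]\le\mathbf{b}[i]$ for all $i$ implies $f_c(\mathbf{a})\le f_c(\mathbf{b})$. Formulas over $\mathcal{C}$ are built from atomic formulas $p(x_1,\dots,x_n)$ (predicate symbols of any arity $n\ge0$, no function or constant symbols) by the connectives of $\mathcal{C}$ and the quantifiers $\forall,\exists$. Classical model $\langle D,J\rangle$: $D$ nonempty, $J(p):D^n\to\{0,1\}$; $[\![p(\vec x)]\!]^\rho=J(p)(\rho(\vec x))$, $[\![c(\alpha_1,\dots,\alpha_k)]\!]^\rho=f_c([\![\alpha_1]\!]^\rho,\dots,[\![\alpha_k]\!]^\rho)$, $[\![\forall x\alpha]\!]^\rho=\min_{a\in D}[\![\alpha]\!]^{\rho[x\mapsto a]}$, $[\![\exists x\alpha]\!]^\rho=\max_{a\in D}[\![\alpha]\!]^{\rho[x\mapsto a]}$. Kripke model $\langle W,\preceq,D,I\rangle$: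 $W$ nonempty, $\preceq$ a preorder, nonempty domains $D(w)$ with $D(w)\subseteq D(v)$ for $w\preceq v$, $I(w,p):D(w)^n\to\{0,1\}$ with $I(w,p)(\vec a)\le I(v,p)(\vec a)$ for $w\preceq v$. For $\rho$ into $D(w)$: $\|p(\vec x)\|_w^\rho=I(w,p)(\rho(\vec x))$; $\|c(\alpha_1,\dots,\alpha_k)\|_w^\rho=1$ iff $f_c(\|\alpha_1\|_v^\rho,\dots,\|\alpha_k\|_v^\rho)=1$ for all $v\succeq w$; $\|\forall x\alpha\|_w^\rho=1$ iff $\|\alpha\|_v^{\rho[x\mapsto a]}=1$ for all $v\succeq w$ and $a\in D(v)$; $\|\exists x\alpha\|_w^\rho=1$ iff $\|\alpha\|_w^{\rho[x\mapsto a]}=1$ for some $a\in D(w)$. The model is constant domain if $D(w)=D(v)$ for all $w,v$; then $D$ denotes this common domain. -}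

module Defs where

open import Data.Bool using (Bool; true; false; _≤_)
open import Data.Nat using (ℕ; _≟_)
open import Data.Fin using (Fin)
open import Data.Product using (Σ)
open import Relation.Nullary using (Dec; does; yes; no)
open import Relation.Binary.PropositionalEquality using (_≡_)

-- Classical metatheory: an excluded-middle oracle (used to turn the
-- quantifier clauses, which range over arbitrary sets, into values in {0,1}).
LEM : Set₁
LEM = (P : Set) → Dec P

record Language : Set₁ where
  field
    Conn  : Set
    ar    : Conn → ℕ
    fc    : (c : Conn) → (Fin (ar c) → Bool) → Bool
    Pred  : Set
    parity : Pred → ℕ
open Language public

Monotonic : {n : ℕ} → ((Fin n → Bool) → Bool) → Set
Monotonic {n} f = (a b : Fin n → Bool) → ((i : Fin n) → a i ≤ b i) → f a ≤ f b

AllMonotonic : Language → Set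
AllMonotonic L = (c : Conn L) → Monotonic (fc L c)

Var : Set
Var = ℕ

data Formula (L : Language) : Set where
  atom : (p : Pred L) → (Fin (parity L p) → Var) → Formula L
  conn : (c : Conn L) → (Fin (ar L c) → Formula L) → Formula L
  all  : Var → Formula L → Formula L
  ex   : Var → Formula L → Formula L

_[_↦_] : {D : Set} → (Var → D) → Var → D → (Var → D)
(ρ [ x ↦ a ]) y with does (x ≟ y)
... | true  = a
... | false = ρ y

record ClassicalModel (L : Language) : Set₁ where
  field
    D   : Set
    d₀  : D
    J   : (p : Pred L) → (Fin (parity L p) → D) → Bool

⟦_⟧ : {L : Language} → LEM → (M : ClassicalModel L) → Formula L
      → (Var → ClassicalModel.D M) → Bool
⟦_⟧ {L} lem M (atom p xs) ρ = ClassicalModel.J M p (λ i → ρ (xs i))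
⟦_⟧ {L} lem M (conn c αs) ρ = fc L c (λ i → ⟦ lem ⟧ M (αs i) ρ)
⟦_⟧ {L} lem M (all x α) ρ =
  does (lem ((a : ClassicalModel.D M) → ⟦ lem ⟧ M α (ρ [ x ↦ a ]) ≡ true))
⟦_⟧ {L} lem M (ex x α) ρ =
  does (lem (Σ (ClassicalModel.D M) λ a → ⟦ lem ⟧ M α (ρ [ x ↦ a ]) ≡ true))

record ConstKripke (L : Language) : Set₁ where
  field
    W        : Set
    _≼_      : W → W → Set
    ≼-refl   : (w : W) → w ≼ w
    ≼-trans  : {u v w : W} → u ≼ v → v ≼ w → u ≼ w
    D        : Set
    d₀       : D
    I        : W → (p : Pred L) → (Fin (parity L p) → D) → Bool
    I-mono   : {w v : W} → w ≼ v → (p : Pred L) → (as : Fin (parity L p) → D)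
               → I w p as ≤ I v p as

‖_‖ : {L : Language} → LEM → (K : ConstKripke L) → Formula L
      → ConstKripke.W K → (Var → ConstKripke.D K) → Bool
‖_‖ {L} lem K (atom p xs) w ρ = ConstKripke.I K w p (λ i → ρ (xs i))
‖_‖ {L} lem K (conn c αs) w ρ =
  does (lem ((v : ConstKripke.W K) → ConstKripke._≼_ K w v
             → fc L c (λ i → ‖ lem ‖ K (αs i) v ρ) ≡ true))
‖_‖ {L} lem K (all x α) w ρ =
  does (lem ((v : ConstKripke.W K) → ConstKripke._≼_ K w v
             → (a : ConstKripke.D K) → ‖ lem ‖ K α v (ρ [ x ↦ a ]) ≡ true))
‖_‖ {L} lem K (ex x α) w ρ =
  does (lem (Σ (ConstKripke.D K) λ a → ‖ lem ‖ K α w (ρ [ x ↦ a ]) ≡ true))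

M[_,_] : {L : Language} → (K : ConstKripke L) → ConstKripke.W K → ClassicalModel L
M[ K , w ] = record { D = ConstKripke.D K ; d₀ = ConstKripke.d₀ K ; J = ConstKripke.I K w }

{-# OPTIONS --safe #-}
module Submission where

-- Under a constant domain, ∀ and ∃ in M[K,w] range over the same elements as in K, so
-- the only difference is that Kripke ∀ and connectives also look at every v ≽ w.
-- Atoms only grow along ≼, and monotone connectives and quantifiers preserve this, so
-- the classical value in M[K,w] is monotone in w. Hence the value at w itself is the
-- least one, and quantifying over v ≽ w changes nothing.

open import Defs
open import Relation.Binary.PropositionalEquality using (_≡_; refl; sym; trans)
open import Data.Bool using (Bool; true; b≤b; f≤t) renaming (_≤_ to _≤ᵇ_)
open import Data.Bool.Properties using (T-≡) renaming (≤-reflexive to ≤ᵇ-reflexive; ≤-trans to ≤ᵇ-trans)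
open import Data.Product using (Σ; _,_)
open import Function.Bundles using (mk⇔; Equivalence)
open import Relation.Nullary using (does; yes; no; contradiction)
open import Relation.Nullary.Decidable using (does-⇔; T?)

≤ᵇ-true : {a b : Bool} → a ≤ᵇ b → a ≡ true → b ≡ true
≤ᵇ-true b≤b a≡true = a≡true

module _ (lem : LEM) where

  does-mono : {P Q : Set} → (P → Q) → does (lem P) ≤ᵇ does (lem Q)
  does-mono {P} {Q} P→Q with lem P | lem Q
  ... | yes p | no ¬q = contradiction (P→Q p) ¬q
  ... | yes _ | yes _ = b≤b
  ... | no _  | yes _ = f≤t
  ... | no _  | no _  = b≤b

  does-≡ : {P Q : Set} → (P → Q) → (Q → P) → does (lem P) ≡ does (lem Q)
  does-≡ P→Q Q→P = does-⇔ (mk⇔ P→Q Q→P) (lem _) (lem _)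

  does-≡-true : {P : Set} (b : Bool) → (P → b ≡ true) → (b ≡ true → P) → does (lem P) ≡ b
  does-≡-true b P→b b→P =
    does-⇔ (mk⇔ (λ p → Equivalence.from T-≡ (P→b p)) (λ t → b→P (Equivalence.to T-≡ t)))
           (lem _) (T? b)

  module _ (L : Language) (mon : AllMonotonic L) (K : ConstKripke L) where
    open ConstKripke K

    ⟦⟧-mono : {w v : W} → w ≼ v → (α : Formula L) (ρ : Var → D)
            → ⟦ lem ⟧ M[ K , w ] α ρ ≤ᵇ ⟦ lem ⟧ M[ K , v ] α ρ
    ⟦⟧-mono w≼v (atom p xs) ρ = I-mono w≼v p (λ i → ρ (xs i))
    ⟦⟧-mono w≼v (conn c αs) ρ = mon c _ _ (λ i → ⟦⟧-mono w≼v (αs i) ρ)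
    ⟦⟧-mono w≼v (all x α)   ρ = does-mono (λ h a → ≤ᵇ-true (⟦⟧-mono w≼v α _) (h a))
    ⟦⟧-mono w≼v (ex x α)    ρ = does-mono (λ { (a , h) → a , ≤ᵇ-true (⟦⟧-mono w≼v α _) h })

    ‖‖≡⟦⟧ : (w : W) (α : Formula L) (ρ : Var → D) → ‖ lem ‖ K α w ρ ≡ ⟦ lem ⟧ M[ K , w ] α ρ
    ‖‖≡⟦⟧ w (atom p xs) ρ = refl
    ‖‖≡⟦⟧ w (conn c αs) ρ = does-≡-true _ at-w at-successors
      where
      at-w : ((v : W) → w ≼ v → fc L c (λ i → ‖ lem ‖ K (αs i) v ρ) ≡ true)
           → fc L c (λ i → ⟦ lem ⟧ M[ K , w ] (αs i) ρ) ≡ true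
      at-w h = ≤ᵇ-true (mon c _ _ (λ i → ≤ᵇ-reflexive (‖‖≡⟦⟧ w (αs i) ρ))) (h w (≼-refl w))

      at-successors : fc L c (λ i → ⟦ lem ⟧ M[ K , w ] (αs i) ρ) ≡ true
                    → (v : W) → w ≼ v → fc L c (λ i → ‖ lem ‖ K (αs i) v ρ) ≡ true
      at-successors h v w≼v =
        ≤ᵇ-true (≤ᵇ-trans (mon c _ _ (λ i → ⟦⟧-mono w≼v (αs i) ρ))
                          (mon c _ _ (λ i → ≤ᵇ-reflexive (sym (‖‖≡⟦⟧ v (αs i) ρ))))) h
    ‖‖≡⟦⟧ w (all x α) ρ = does-≡
      (λ h a → trans (sym (‖‖≡⟦⟧ w α _)) (h w (≼-refl w) a))
      (λ h v w≼v a → trans (‖‖≡⟦⟧ v α _) (≤ᵇ-true (⟦⟧-mono w≼v α _) (h a)))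
    ‖‖≡⟦⟧ w (ex x α) ρ = does-≡
      (λ { (a , h) → a , trans (sym (‖‖≡⟦⟧ w α _)) h })
      (λ { (a , h) → a , trans (‖‖≡⟦⟧ w α _) h })

lemma3 : (lem : LEM) (L : Language) → AllMonotonic L
         → (K : ConstKripke L) (w : ConstKripke.W K)
         → (α : Formula L) (ρ : Var → ConstKripke.D K)
         → ‖ lem ‖ K α w ρ ≡ ⟦ lem ⟧ M[ K , w ] α ρ
lemma3 lem L mon K = ‖‖≡⟦⟧ lem L mon K
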